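{- For any positive integer $k$, $$S_t\Big(\frac{1}{1-z_ku}\Big)\ast\frac{1}{1+z_ku}=\frac{1}{1-\sum_{i=2}^\infty t^{i-2}(t-1)z_{ik}u^i}.$$
   Context: Let $\mathfrak{h}_t=\mathbb{Q}[t]\langle x,y\rangle$ ($t$ a variable) be the noncommutative polynomial algebra in letters $x,y$, $\mathfrak{h}_t^1=\mathbb{Q}[t]+\mathfrak{h}_ty$, $z_k=x^{k-1}y$. The harmonic product $\ast$ on $\mathfrak{h}_t^1$ is $\mathbb{Q}[t]$-bilinear with $1\ast w=w\ast1=w$ and $z_kw_1\ast z_lw_2=z_k(w_1\ast z_lw_2)+z_l(z_kw_1\ast w_2)+z_{k+l}(w_1\ast w_2)$ for words $w_1,w_2\in\mathfrak{h}_t^1$. $\sigma_t$ is the concatenation automorphism with $\sigma_t(x)=x$, $\sigma_t(y)=tx+y$; $S_t$ is the $\mathbb{Q}[t]$-linear map with $S_t(1)=1$, $S_t(wa)=\sigma_t(w)a$ for words $w$ and letters $a$. $u$ is a formal commuting variable; $S_t$ and $\ast$ are extended to power series in $u$ coefficientwise; $\frac{1}{1-X}$ denotes the concatenation geometric series $\sum_{m\geq0}X^m$ (so $\frac{1}{1\pm z_ku}=\sum_{n\ge0}(\mp1)^nz_k^nu^n$ with concatenation powers). -}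

module Defs where

open import Data.Nat using (ℕ; zero; suc; _+_; _*_; _∸_)
open import Data.Rational using (ℚ; 0ℚ; 1ℚ; -_) renaming (_+_ to _+ℚ_; _*_ to _*ℚ_)
open import Data.List using (List; []; _∷_; _++_; map; concat; concatMap; replicate; upTo; foldr)
open import Data.Product using (_×_; _,_)
open import Data.Bool using (if_then_else_; _∧_)
open import Relation.Nullary.Decidable using (⌊_⌋)
open import Relation.Binary.PropositionalEquality using (_≡_)
import Data.List.Properties as LP
import Data.Nat as N

data Letter : Set where
  x y : Letter

_≟L_ : (a b : Letter) → Relation.Nullary.Decidable.Dec (a ≡ b)
x ≟L x = Relation.Nullary.Decidable.yes Relation.Binary.PropositionalEquality.refl
y ≟L y = Relation.Nullary.Decidable.yes Relation.Binary.PropositionalEquality.refl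
x ≟L y = Relation.Nullary.Decidable.no (λ ())
y ≟L x = Relation.Nullary.Decidable.no (λ ())

Word : Set
Word = List Letter

_≟W_ : (v w : Word) → Relation.Nullary.Decidable.Dec (v ≡ w)
_≟W_ = LP.≡-dec _≟L_

-- Elements of 𝔥_t = ℚ[t]⟨x,y⟩ : finite formal sums of terms  q · t^j · w
-- (a term (q , j , w) stands for q t^j w).

Term : Set
Term = ℚ × ℕ × Word

Poly : Set
Poly = List Term

coeff : ℕ → Word → Poly → ℚ
coeff j w [] = 0ℚ
coeff j w ((q , i , v) ∷ P) =
  (if ⌊ i N.≟ j ⌋ ∧ ⌊ v ≟W w ⌋ then q else 0ℚ) +ℚ coeff j w P

_≈_ : Poly → Poly → Set
P ≈ Q = ∀ (j : ℕ) (w : Word) → coeff j w P ≡ coeff j w Q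

infix 4 _≈_

zeroP : Poly
zeroP = []

oneP : Poly
oneP = (1ℚ , 0 , []) ∷ []

word : Word → Poly
word w = (1ℚ , 0 , w) ∷ []

scale : ℚ → Poly → Poly
scale c = map (λ { (q , j , w) → (c *ℚ q , j , w) })

sumP : List Poly → Poly
sumP = concat

bilin : (Word → Word → Poly) → Poly → Poly → Poly
bilin op P Q =
  concatMap (λ { (q , i , v) →
    concatMap (λ { (q' , i' , v') →
      map (λ { (r , l , u) → (q *ℚ q' *ℚ r , i + i' + l , u) }) (op v v') }) Q }) P

_·_ : Poly → Poly → Poly
_·_ = bilin (λ v w → word (v ++ w))

infixl 7 _·_

zw : ℕ → Word
zw k = replicate (k ∸ 1) x ++ (y ∷ [])

zpow : ℕ → ℕ → Word
zpow k n = concat (replicate n (zw k))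

σL : Letter → Poly
σL x = word (x ∷ [])
σL y = (1ℚ , 1 , x ∷ []) ∷ (1ℚ , 0 , y ∷ []) ∷ []

-- S_t on words:  S_t(1) = 1,  S_t(w a) = σ_t(w) a
-- St' a w  =  S_t(a w)
St' : Letter → Word → Poly
St' a [] = word (a ∷ [])
St' a (b ∷ w) = σL a · St' b w

St : Word → Poly
St [] = oneP
St (a ∷ w) = St' a w

StP : Poly → Poly
StP = concatMap (λ { (q , j , w) → map (λ { (r , l , u) → (q *ℚ r , j + l , u) }) (St w) })

-- Harmonic product.  Words of 𝔥^1 are z_{k1}⋯z_{kr}; we encode them by the
-- index list (k1,…,kr).

harmIdx : List ℕ → List ℕ → List (List ℕ)
harmIdx [] v = v ∷ []
harmIdx (a ∷ u) [] = (a ∷ u) ∷ []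
harmIdx (a ∷ u) (b ∷ v) =
  map (a ∷_) (harmIdx u (b ∷ v)) ++
  map (b ∷_) (harmIdx (a ∷ u) v) ++
  map ((a + b) ∷_) (harmIdx u v)

fromIdx : List ℕ → Word
fromIdx = concatMap zw

-- decompose a word as z_{k1}⋯z_{kr} x^c ; returns ((k1,…,kr) , c)
toIdx' : ℕ → Word → List ℕ × ℕ
toIdx' c [] = [] , c
toIdx' c (x ∷ w) = toIdx' (suc c) w
toIdx' c (y ∷ w) with toIdx' 0 w
... | is , r = suc c ∷ is , r

toIdx : Word → List ℕ × ℕ
toIdx = toIdx' 0

-- harmonic product of two words of 𝔥^1 (words ending in y, or empty);
-- words outside 𝔥^1 never occur below, they are sent to 0 by convention.
harmW : Word → Word → Poly
harmW v w with toIdx v | toIdx w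
... | is , zero | js , zero = map (λ ks → (1ℚ , 0 , fromIdx ks)) (harmIdx is js)
... | _ | _ = zeroP

_⋆_ : Poly → Poly → Poly
_⋆_ = bilin harmW

-- Formal power series in u with coefficients in 𝔥_t : ℕ → Poly
-- (coefficient of u^n).

PS : Set
PS = ℕ → Poly

cauchy : (Poly → Poly → Poly) → PS → PS → PS
cauchy op f g n = sumP (map (λ a → op (f a) (g (n ∸ a))) (upTo (suc n)))

onePS : PS
onePS zero = oneP
onePS (suc n) = zeroP

powPS : PS → ℕ → PS
powPS f zero = onePS
powPS f (suc m) = cauchy _·_ f (powPS f m)

-- 1/(1-F) = Σ_{m≥0} F^m for F with zero constant term: only m ≤ n
-- contributes to the coefficient of u^n.
geomPS : PS → PS
geomPS f n = sumP (map (λ m → powPS f m n) (upTo (suc n)))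

geomPlus : ℕ → PS
geomPlus k n = word (zpow k n)

signQ : ℕ → ℚ
signQ zero = 1ℚ
signQ (suc n) = - signQ n

geomMinus : ℕ → PS
geomMinus k n = scale (signQ n) (word (zpow k n))

serA : ℕ → PS
serA k zero = zeroP
serA k (suc zero) = zeroP
serA k (suc (suc m)) =
  (1ℚ , suc m , zw ((suc (suc m)) * k)) ∷ (- 1ℚ , m , zw ((suc (suc m)) * k)) ∷ []

lhs : ℕ → PS
lhs k = cauchy _⋆_ (λ n → StP (geomPlus k n)) (geomMinus k)

rhs : ℕ → PS
rhs k = geomPS (serA k)

-- Write Ŝ = S_t(1/(1 - z_k u)) and Ĉ = 1/(1 + z_k u).  Since σ_t(z_k) = z_k + t x^k, a word
-- z_k^(m+1) is sent by S_t to Σ_i t^i z_((i+1)k) S_t(z_k^(m-i)), i.e.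
-- Ŝ = 1 + Σ_i t^i z_((i+1)k) u^(i+1) Ŝ, while Ĉ = 1 - z_k u Ĉ.  Expanding L = Ŝ ⋆ Ĉ by the
-- recursive definition of ⋆ gives
--   L = 1 + Σ_i t^i z_((i+1)k) u^(i+1) L - z_k u L - Σ_i t^i z_((i+2)k) u^(i+2) L,
-- where the term i = 0 of the first sum cancels z_k u L.  What is left is L = 1 + A L with
-- A = Σ_(i≥2) t^(i-2) (t-1) z_(ik) u^i; the geometric series 1/(1 - A) satisfies the same
-- recursion, which determines the coefficients uniquely because A has no constant term.
-- Polynomials are lists of terms compared coefficientwise, so every operation used is first
-- shown to respect that equality: a ℚ-linear functional of a list only depends on its
-- coefficients.

module Submission where

open import Defs
open import Data.Nat using (ℕ; zero; suc; _+_; _*_; _∸_; _≤_; _<_; z≤n; s≤s)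
import Data.Nat as ℕ
import Data.Nat.Properties as ℕ
import Data.Nat.Tactic.RingSolver as ℕ-Ring
open import Data.Rational using (ℚ; 0ℚ; 1ℚ; -_) renaming (_+_ to _+ℚ_; _*_ to _*ℚ_)
import Data.Rational.Properties as ℚ
open import Data.Rational.Solver using (module +-*-Solver)
open import Data.List using (List; []; _∷_; _++_; map; concat; concatMap; replicate; upTo; applyUpTo; length)
import Data.List.Properties as List
open import Data.Product using (_×_; _,_; proj₁; proj₂)
open import Data.Bool using (Bool; true; false; if_then_else_; _∧_)
open import Data.Empty using (⊥-elim)
open import Data.Sum using (inj₁; inj₂)
open import Function using (_∘_)
open import Relation.Nullary using (¬_; yes; no)
open import Relation.Nullary.Decidable using (⌊_⌋)
open import Relation.Nullary.Reflects using (Reflects; ofʸ; ofⁿ)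
open import Relation.Binary.PropositionalEquality
open import Relation.Binary.Bundles using (Setoid)
open import Algebra.Bundles using (CommutativeMonoid)
import Relation.Binary.Reasoning.Setoid as SetoidReasoning
import Algebra.Solver.CommutativeMonoid as CommutativeMonoidSolver

sameMonomial : ℕ → Word → ℕ → Word → Bool
sameMonomial i v j w = ⌊ i ℕ.≟ j ⌋ ∧ ⌊ v ≟W w ⌋

sameMonomial-reflects : ∀ i v j w → Reflects (i ≡ j × v ≡ w) (sameMonomial i v j w)
sameMonomial-reflects i v j w with i ℕ.≟ j | v ≟W w
... | yes i≡j | yes v≡w = ofʸ (i≡j , v≡w)
... | yes _   | no v≢w  = ofⁿ (v≢w ∘ proj₂)
... | no i≢j  | _       = ofⁿ (i≢j ∘ proj₁)

coeff-++ : ∀ j w P Q → coeff j w (P ++ Q) ≡ coeff j w P +ℚ coeff j w Q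
coeff-++ j w [] Q = sym (ℚ.+-identityˡ (coeff j w Q))
coeff-++ j w ((q , i , v) ∷ P) Q =
  trans (cong (c +ℚ_) (coeff-++ j w P Q)) (sym (ℚ.+-assoc c (coeff j w P) (coeff j w Q)))
  where c = if sameMonomial i v j w then q else 0ℚ

record _≋_ (P Q : Poly) : Set where
  constructor coeffwise
  field coeff-≡ : P ≈ Q
open _≋_ public
infix 4 _≋_

≋-setoid : Setoid _ _
≋-setoid = record
  { Carrier = Poly
  ; _≈_ = _≋_
  ; isEquivalence = record
    { refl = coeffwise λ j w → refl
    ; sym = λ e → coeffwise λ j w → sym (coeff-≡ e j w)
    ; trans = λ e f → coeffwise λ j w → trans (coeff-≡ e j w) (coeff-≡ f j w)
    }
  }

open Setoid ≋-setoid public using () renaming (refl to ≋-refl; sym to ≋-sym; trans to ≋-trans; reflexive to ≡⇒≋)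

module ≋-Reasoning = SetoidReasoning ≋-setoid

++-cong : ∀ {P P' Q Q'} → P ≋ P' → Q ≋ Q' → P ++ Q ≋ P' ++ Q'
++-cong {P} {P'} {Q} {Q'} e f = coeffwise λ j w → begin
  coeff j w (P ++ Q)                ≡⟨ coeff-++ j w P Q ⟩
  coeff j w P +ℚ coeff j w Q        ≡⟨ cong₂ _+ℚ_ (coeff-≡ e j w) (coeff-≡ f j w) ⟩
  coeff j w P' +ℚ coeff j w Q'      ≡⟨ coeff-++ j w P' Q' ⟨
  coeff j w (P' ++ Q')              ∎
  where open ≡-Reasoning

++-congˡ : ∀ P {Q Q'} → Q ≋ Q' → P ++ Q ≋ P ++ Q'
++-congˡ P = ++-cong (≋-refl {x = P})

++-congʳ : ∀ Q {P P'} → P ≋ P' → P ++ Q ≋ P' ++ Q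
++-congʳ Q e = ++-cong e (≋-refl {x = Q})

++-comm : ∀ P Q → P ++ Q ≋ Q ++ P
++-comm P Q = coeffwise λ j w →
  trans (coeff-++ j w P Q) (trans (ℚ.+-comm (coeff j w P) (coeff j w Q)) (sym (coeff-++ j w Q P)))

++-commutativeMonoid : CommutativeMonoid _ _
++-commutativeMonoid = record
  { Carrier = Poly
  ; _≈_ = _≋_
  ; _∙_ = _++_
  ; ε = []
  ; isCommutativeMonoid = record
    { isMonoid = record
      { isSemigroup = record
        { isMagma = record { isEquivalence = Setoid.isEquivalence ≋-setoid ; ∙-cong = ++-cong }
        ; assoc = λ P Q R → ≡⇒≋ (List.++-assoc P Q R)
        }
      ; identity = (λ P → ≋-refl) , (λ P → ≡⇒≋ (List.++-identityʳ P))
      }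
    ; comm = ++-comm
    }
  }

module ++-Solver = CommutativeMonoidSolver ++-commutativeMonoid

++-interchange : ∀ P Q R S → (P ++ Q) ++ (R ++ S) ≋ (P ++ R) ++ (Q ++ S)
++-interchange = solve 4 (λ p q r s → (p ⊕ q) ⊕ (r ⊕ s) ⊜ (p ⊕ r) ⊕ (q ⊕ s)) ≋-refl
  where open ++-Solver

linExt : (ℕ → Word → ℚ) → Poly → ℚ
linExt g [] = 0ℚ
linExt g ((q , i , v) ∷ P) = q *ℚ g i v +ℚ linExt g P

dropMonomial : ℕ → Word → Poly → Poly
dropMonomial j w [] = []
dropMonomial j w ((q , i , v) ∷ P) =
  if sameMonomial i v j w then dropMonomial j w P else (q , i , v) ∷ dropMonomial j w P

linExt-dropMonomial : ∀ g j w P → linExt g P ≡ coeff j w P *ℚ g j w +ℚ linExt g (dropMonomial j w P)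
linExt-dropMonomial g j w [] = solve 1 (λ a → con 0ℚ := con 0ℚ :* a :+ con 0ℚ) refl (g j w)
  where open +-*-Solver
linExt-dropMonomial g j w ((q , i , v) ∷ P)
  with sameMonomial i v j w | sameMonomial-reflects i v j w | linExt-dropMonomial g j w P
... | true | ofʸ (refl , refl) | eq =
  trans (cong (q *ℚ g i v +ℚ_) eq)
        (solve 4 (λ q a c l → q :* a :+ (c :* a :+ l) := (q :+ c) :* a :+ l) refl
               q (g i v) (coeff i v P) (linExt g (dropMonomial i v P)))
  where open +-*-Solver
... | false | ofⁿ _ | eq =
  trans (cong (q *ℚ g i v +ℚ_) eq)
        (solve 5 (λ q a c b l → q :* a :+ (c :* b :+ l) := (con 0ℚ :+ c) :* b :+ (q :* a :+ l)) refl
               q (g i v) (coeff j w P) (g j w) (linExt g (dropMonomial j w P)))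
  where open +-*-Solver

coeff-dropMonomial-same : ∀ j w P → coeff j w (dropMonomial j w P) ≡ 0ℚ
coeff-dropMonomial-same j w [] = refl
coeff-dropMonomial-same j w ((q , i , v) ∷ P)
  with sameMonomial i v j w | sameMonomial-reflects i v j w
... | true  | _      = coeff-dropMonomial-same j w P
... | false | ofⁿ ne with sameMonomial i v j w | sameMonomial-reflects i v j w
...   | true  | ofʸ same = ⊥-elim (ne same)
...   | false | _        = trans (ℚ.+-identityˡ _) (coeff-dropMonomial-same j w P)

coeff-dropMonomial-other : ∀ j w j' w' P → ¬ (j' ≡ j × w' ≡ w) →
                           coeff j' w' (dropMonomial j w P) ≡ coeff j' w' P
coeff-dropMonomial-other j w j' w' [] _ = refl
coeff-dropMonomial-other j w j' w' ((q , i , v) ∷ P) ne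
  with sameMonomial i v j w | sameMonomial-reflects i v j w
... | false | _ = cong ((if sameMonomial i v j' w' then q else 0ℚ) +ℚ_) (coeff-dropMonomial-other j w j' w' P ne)
... | true | ofʸ (refl , refl) with sameMonomial i v j' w' | sameMonomial-reflects i v j' w'
...   | true  | ofʸ (refl , refl) = ⊥-elim (ne (refl , refl))
...   | false | _ = trans (coeff-dropMonomial-other i v j' w' P ne) (sym (ℚ.+-identityˡ _))

dropMonomial-cong : ∀ j w {P P'} → P ≋ P' → dropMonomial j w P ≋ dropMonomial j w P'
dropMonomial-cong j w {P} {P'} e = coeffwise λ j' w' → on j' w' (sameMonomial-reflects j' w' j w)
  where
  on : ∀ j' w' {b} → Reflects (j' ≡ j × w' ≡ w) b →
       coeff j' w' (dropMonomial j w P) ≡ coeff j' w' (dropMonomial j w P')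
  on j' w' (ofʸ (refl , refl)) =
    trans (coeff-dropMonomial-same j w P) (sym (coeff-dropMonomial-same j w P'))
  on j' w' (ofⁿ ne) = begin
    coeff j' w' (dropMonomial j w P)   ≡⟨ coeff-dropMonomial-other j w j' w' P ne ⟩
    coeff j' w' P                      ≡⟨ coeff-≡ e j' w' ⟩
    coeff j' w' P'                     ≡⟨ coeff-dropMonomial-other j w j' w' P' ne ⟨
    coeff j' w' (dropMonomial j w P')  ∎
    where open ≡-Reasoning

length-dropMonomial : ∀ j w P → length (dropMonomial j w P) ≤ length P
length-dropMonomial j w [] = z≤n
length-dropMonomial j w ((q , i , v) ∷ P) with sameMonomial i v j w
... | true  = ℕ.m≤n⇒m≤1+n (length-dropMonomial j w P)
... | false = s≤s (length-dropMonomial j w P)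

length-dropMonomial-head : ∀ q i v P → length (dropMonomial i v ((q , i , v) ∷ P)) ≤ length P
length-dropMonomial-head q i v P with sameMonomial i v i v | sameMonomial-reflects i v i v
... | true  | _      = length-dropMonomial i v P
... | false | ofⁿ ne = ⊥-elim (ne (refl , refl))

linExt-cong : ∀ g {P P'} → P ≋ P' → linExt g P ≡ linExt g P'
linExt-cong g {P} {P'} = go (length P + length P') P P' ℕ.≤-refl
  where
  dropBoth : ∀ j w {P P'} → P ≋ P' →
             linExt g (dropMonomial j w P) ≡ linExt g (dropMonomial j w P') → linExt g P ≡ linExt g P'
  dropBoth j w {P} {P'} e e' = begin
    linExt g P
      ≡⟨ linExt-dropMonomial g j w P ⟩
    coeff j w P *ℚ g j w +ℚ linExt g (dropMonomial j w P)
      ≡⟨ cong₂ (λ c l → c *ℚ g j w +ℚ l) (coeff-≡ e j w) e' ⟩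
    coeff j w P' *ℚ g j w +ℚ linExt g (dropMonomial j w P')
      ≡⟨ linExt-dropMonomial g j w P' ⟨
    linExt g P' ∎
    where open ≡-Reasoning

  -- dropping the monomial of a head term strictly decreases the total number of terms
  go : ∀ n P P' → length P + length P' ≤ n → P ≋ P' → linExt g P ≡ linExt g P'
  go n [] [] _ _ = refl
  go zero ((q , i , v) ∷ P) P' () e
  go zero [] ((q , i , v) ∷ P') () e
  go (suc n) ((q , i , v) ∷ P) P' (s≤s le) e =
    dropBoth i v e (go n _ _ (ℕ.≤-trans (ℕ.+-mono-≤ (length-dropMonomial-head q i v P) (length-dropMonomial i v P')) le)
                        (dropMonomial-cong i v e))
  go (suc n) [] ((q , i , v) ∷ P') (s≤s le) e =
    dropBoth i v e (go n _ _ (ℕ.≤-trans (length-dropMonomial-head q i v P') le) (dropMonomial-cong i v e))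

mulTerm : ℚ → ℕ → Word → Term → Term
mulTerm c d v (r , l , u) = (c *ℚ r , d + l , v ++ u)

lmul : ℚ → ℕ → Word → Poly → Poly
lmul c d v = map (mulTerm c d v)

coeff-lmul : ∀ j w c d v P →
             coeff j w (lmul c d v P) ≡ linExt (λ i u → if sameMonomial (d + i) (v ++ u) j w then c else 0ℚ) P
coeff-lmul j w c d v [] = refl
coeff-lmul j w c d v ((r , l , u) ∷ P) =
  cong₂ _+ℚ_ (if-*-comm (sameMonomial (d + l) (v ++ u) j w)) (coeff-lmul j w c d v P)
  where
  if-*-comm : ∀ b → (if b then c *ℚ r else 0ℚ) ≡ r *ℚ (if b then c else 0ℚ)
  if-*-comm true  = ℚ.*-comm c r
  if-*-comm false = sym (ℚ.*-zeroʳ r)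

lmul-cong : ∀ c d v {P P'} → P ≋ P' → lmul c d v P ≋ lmul c d v P'
lmul-cong c d v {P} {P'} e = coeffwise λ j w →
  trans (coeff-lmul j w c d v P) (trans (linExt-cong _ e) (sym (coeff-lmul j w c d v P')))

coeff-lmul-* : ∀ j w a b d v P → coeff j w (lmul (a *ℚ b) d v P) ≡ a *ℚ coeff j w (lmul b d v P)
coeff-lmul-* j w a b d v [] = sym (ℚ.*-zeroʳ a)
coeff-lmul-* j w a b d v ((r , l , u) ∷ P) =
  trans (cong₂ _+ℚ_ (if-*-assoc (sameMonomial (d + l) (v ++ u) j w)) (coeff-lmul-* j w a b d v P))
        (sym (ℚ.*-distribˡ-+ a _ _))
  where
  if-*-assoc : ∀ s → (if s then a *ℚ b *ℚ r else 0ℚ) ≡ a *ℚ (if s then b *ℚ r else 0ℚ)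
  if-*-assoc true  = ℚ.*-assoc a b r
  if-*-assoc false = sym (ℚ.*-zeroʳ a)

coeff-lmul-scalar : ∀ j w a d v P → coeff j w (lmul a d v P) ≡ a *ℚ coeff j w (lmul 1ℚ d v P)
coeff-lmul-scalar j w a d v P =
  trans (cong (λ b → coeff j w (lmul b d v P)) (sym (ℚ.*-identityʳ a))) (coeff-lmul-* j w a 1ℚ d v P)

lmul-cancel : ∀ c d v P → lmul c d v P ++ lmul (- c) d v P ≋ []
lmul-cancel c d v P = coeffwise λ j w → begin
  coeff j w (lmul c d v P ++ lmul (- c) d v P)
    ≡⟨ coeff-++ j w (lmul c d v P) (lmul (- c) d v P) ⟩
  coeff j w (lmul c d v P) +ℚ coeff j w (lmul (- c) d v P)
    ≡⟨ cong₂ _+ℚ_ (coeff-lmul-scalar j w c d v P) (coeff-lmul-scalar j w (- c) d v P) ⟩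
  c *ℚ coeff j w (lmul 1ℚ d v P) +ℚ (- c) *ℚ coeff j w (lmul 1ℚ d v P)
    ≡⟨ solve 2 (λ c x → c :* x :+ (:- c) :* x := con 0ℚ) refl c (coeff j w (lmul 1ℚ d v P)) ⟩
  0ℚ ∎
  where
  open ≡-Reasoning
  open +-*-Solver

lmul-lmul : ∀ c d v c' d' v' P → lmul c d v (lmul c' d' v' P) ≡ lmul (c *ℚ c') (d + d') (v ++ v') P
lmul-lmul c d v c' d' v' P = trans (sym (List.map-∘ P)) (List.map-cong compose P)
  where
  compose : ∀ t → mulTerm c d v (mulTerm c' d' v' t) ≡ mulTerm (c *ℚ c') (d + d') (v ++ v') t
  compose (r , l , u) =
    cong₂ _,_ (sym (ℚ.*-assoc c c' r)) (cong₂ _,_ (sym (ℕ.+-assoc d d' l)) (sym (List.++-assoc v v' u)))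

lmul-≡ : ∀ {c c' d d' v v'} P → c ≡ c' → d ≡ d' → v ≡ v' → lmul c d v P ≡ lmul c' d' v' P
lmul-≡ P refl refl refl = refl

lmul-identity : ∀ P → lmul 1ℚ 0 [] P ≡ P
lmul-identity P = trans (List.map-cong (λ { (r , l , u) → cong (_, l , u) (ℚ.*-identityˡ r) }) P) (List.map-id P)

module _ {A : Set} where

  concatMap-cong : ∀ {f g : A → Poly} X → (∀ a → f a ≋ g a) → concatMap f X ≋ concatMap g X
  concatMap-cong []      e = ≋-refl
  concatMap-cong (a ∷ X) e = ++-cong (e a) (concatMap-cong X e)

  concatMap-split : ∀ (f g : A → Poly) X → concatMap (λ a → f a ++ g a) X ≋ concatMap f X ++ concatMap g X
  concatMap-split f g []      = ≋-refl
  concatMap-split f g (a ∷ X) = begin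
    (f a ++ g a) ++ concatMap (λ a → f a ++ g a) X     ≈⟨ ++-congˡ _ (concatMap-split f g X) ⟩
    (f a ++ g a) ++ (concatMap f X ++ concatMap g X)   ≈⟨ ++-interchange (f a) (g a) (concatMap f X) (concatMap g X) ⟩
    (f a ++ concatMap f X) ++ (g a ++ concatMap g X)   ∎
    where open ≋-Reasoning

  concatMap-[] : ∀ (X : List A) → concatMap (λ _ → zeroP) X ≡ zeroP
  concatMap-[] []      = refl
  concatMap-[] (a ∷ X) = concatMap-[] X

concatMap-concat : ∀ {A : Set} (f : A → Poly) Xs → concatMap f (concat Xs) ≡ concat (map (concatMap f) Xs)
concatMap-concat f []       = refl
concatMap-concat f (X ∷ Xs) = trans (List.concatMap-++ f X (concat Xs)) (cong (concatMap f X ++_) (concatMap-concat f Xs))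

termProduct : (Word → Word → Poly) → Term → Term → Poly
termProduct op (q , i , v) (q' , i' , v') = lmul (q *ℚ q') (i + i') [] (op v v')

sumProducts : (Term → Term → Poly) → Poly → Poly → Poly
sumProducts F P Q = concatMap (λ t → concatMap (F t) Q) P

lmul-sumProducts : ∀ c d v F P Q →
                   lmul c d v (sumProducts F P Q) ≡ sumProducts (λ t t' → lmul c d v (F t t')) P Q
lmul-sumProducts c d v F P Q =
  trans (List.map-concatMap (mulTerm c d v) _ P)
        (List.concatMap-cong (λ t → List.map-concatMap (mulTerm c d v) (F t) Q) P)

sumProducts-mapˡ : ∀ F g P Q → sumProducts F (map g P) Q ≡ sumProducts (λ t t' → F (g t) t') P Q
sumProducts-mapˡ F g P Q = List.concatMap-map _ g P

sumProducts-mapʳ : ∀ F g P Q → sumProducts F P (map g Q) ≡ sumProducts (λ t t' → F t (g t')) P Q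
sumProducts-mapʳ F g P Q = List.concatMap-cong (λ t → List.concatMap-map (F t) g Q) P

sumProducts-split : ∀ F G P Q → sumProducts (λ t t' → F t t' ++ G t t') P Q ≋ sumProducts F P Q ++ sumProducts G P Q
sumProducts-split F G P Q =
  ≋-trans (concatMap-cong P (λ t → concatMap-split (F t) (G t) Q)) (concatMap-split _ _ P)

sumProducts-≡ : ∀ {F G} P Q → (∀ t t' → F t t' ≡ G t t') → sumProducts F P Q ≡ sumProducts G P Q
sumProducts-≡ P Q e = List.concatMap-cong (λ t → List.concatMap-cong (e t) Q) P

module _ (op : Word → Word → Poly) where

  monomialProduct : ℕ → Word → Poly → Poly
  monomialProduct i v Q = concatMap (λ { (q' , i' , v') → lmul q' (i + i') [] (op v v') }) Q

  coeff-termProducts-scalar : ∀ j w q i v Q →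
    coeff j w (concatMap (termProduct op (q , i , v)) Q) ≡ q *ℚ coeff j w (monomialProduct i v Q)
  coeff-termProducts-scalar j w q i v [] = sym (ℚ.*-zeroʳ q)
  coeff-termProducts-scalar j w q i v ((q' , i' , v') ∷ Q) = begin
    coeff j w (lmul (q *ℚ q') (i + i') [] (op v v') ++ concatMap (termProduct op (q , i , v)) Q)
      ≡⟨ coeff-++ j w (lmul (q *ℚ q') (i + i') [] (op v v')) _ ⟩
    coeff j w (lmul (q *ℚ q') (i + i') [] (op v v')) +ℚ coeff j w (concatMap (termProduct op (q , i , v)) Q)
      ≡⟨ cong₂ _+ℚ_ (coeff-lmul-* j w q q' (i + i') [] (op v v')) (coeff-termProducts-scalar j w q i v Q) ⟩
    q *ℚ coeff j w (lmul q' (i + i') [] (op v v')) +ℚ q *ℚ coeff j w (monomialProduct i v Q)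
      ≡⟨ ℚ.*-distribˡ-+ q _ _ ⟨
    q *ℚ (coeff j w (lmul q' (i + i') [] (op v v')) +ℚ coeff j w (monomialProduct i v Q))
      ≡⟨ cong (q *ℚ_) (coeff-++ j w (lmul q' (i + i') [] (op v v')) (monomialProduct i v Q)) ⟨
    q *ℚ coeff j w (monomialProduct i v ((q' , i' , v') ∷ Q)) ∎
    where open ≡-Reasoning

  coeff-bilin : ∀ j w P Q → coeff j w (bilin op P Q) ≡ linExt (λ i v → coeff j w (monomialProduct i v Q)) P
  coeff-bilin j w []                Q = refl
  coeff-bilin j w ((q , i , v) ∷ P) Q =
    trans (coeff-++ j w (concatMap (termProduct op (q , i , v)) Q) (bilin op P Q))
          (cong₂ _+ℚ_ (coeff-termProducts-scalar j w q i v Q) (coeff-bilin j w P Q))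

  coeff-termProducts : ∀ j w q i v Q →
    coeff j w (concatMap (termProduct op (q , i , v)) Q) ≡ linExt (λ i' v' → coeff j w (lmul q (i + i') [] (op v v'))) Q
  coeff-termProducts j w q i v [] = refl
  coeff-termProducts j w q i v ((q' , i' , v') ∷ Q) =
    trans (coeff-++ j w (lmul (q *ℚ q') (i + i') [] (op v v')) (concatMap (termProduct op (q , i , v)) Q))
          (cong₂ _+ℚ_ (trans (cong (λ c → coeff j w (lmul c (i + i') [] (op v v'))) (ℚ.*-comm q q'))
                             (coeff-lmul-* j w q' q (i + i') [] (op v v')))
                      (coeff-termProducts j w q i v Q))

  bilin-congˡ : ∀ {P P'} Q → P ≋ P' → bilin op P Q ≋ bilin op P' Q
  bilin-congˡ {P} {P'} Q e = coeffwise λ j w →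
    trans (coeff-bilin j w P Q) (trans (linExt-cong _ e) (sym (coeff-bilin j w P' Q)))

  bilin-congʳ : ∀ P {Q Q'} → Q ≋ Q' → bilin op P Q ≋ bilin op P Q'
  bilin-congʳ P {Q} {Q'} e = concatMap-cong P λ { (q , i , v) → coeffwise λ j w →
    trans (coeff-termProducts j w q i v Q) (trans (linExt-cong _ e) (sym (coeff-termProducts j w q i v Q'))) }

  bilin-cong : ∀ {P P' Q Q'} → P ≋ P' → Q ≋ Q' → bilin op P Q ≋ bilin op P' Q'
  bilin-cong {P} {P'} {Q} e f = ≋-trans (bilin-congˡ Q e) (bilin-congʳ P' f)

  bilin-++ˡ : ∀ P P' Q → bilin op (P ++ P') Q ≡ bilin op P Q ++ bilin op P' Q
  bilin-++ˡ P P' Q = List.concatMap-++ _ P P'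

  bilin-++ʳ : ∀ P Q Q' → bilin op P (Q ++ Q') ≋ bilin op P Q ++ bilin op P Q'
  bilin-++ʳ P Q Q' =
    ≋-trans (≡⇒≋ (List.concatMap-cong (λ t → List.concatMap-++ (termProduct op t) Q Q') P))
            (concatMap-split _ _ P)

  bilin-zeroʳ : ∀ P → bilin op P [] ≡ []
  bilin-zeroʳ P = concatMap-[] P

  bilin-vanishesʳ : ∀ P {Q} → Q ≋ [] → bilin op P Q ≋ []
  bilin-vanishesʳ P Q≋0 = ≋-trans (bilin-congʳ P Q≋0) (≡⇒≋ (bilin-zeroʳ P))

sumBelow : ℕ → (ℕ → Poly) → Poly
sumBelow n f = concat (applyUpTo f n)

infix 5 sumBelow
syntax sumBelow n (λ a → e) = ∑[ a < n ] e

concat-map-upTo : ∀ f n → concat (map f (upTo n)) ≡ sumBelow n f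
concat-map-upTo f n = cong concat (List.map-applyUpTo (λ a → a) f n)

sum-last : ∀ n f → sumBelow (suc n) f ≡ sumBelow n f ++ f n
sum-last zero    f = List.++-identityʳ (f 0)
sum-last (suc n) f =
  trans (cong (f 0 ++_) (sum-last n (f ∘ suc))) (sym (List.++-assoc (f 0) (sumBelow n (f ∘ suc)) (f (suc n))))

sum-cong : ∀ n {f g} → (∀ a → a < n → f a ≋ g a) → sumBelow n f ≋ sumBelow n g
sum-cong zero    e = ≋-refl
sum-cong (suc n) e = ++-cong (e 0 (s≤s z≤n)) (sum-cong n (λ a a<n → e (suc a) (s≤s a<n)))

sum-cong-≡ : ∀ n {f g} → (∀ a → a < n → f a ≡ g a) → sumBelow n f ≡ sumBelow n g
sum-cong-≡ zero    e = refl
sum-cong-≡ (suc n) e = cong₂ _++_ (e 0 (s≤s z≤n)) (sum-cong-≡ n (λ a a<n → e (suc a) (s≤s a<n)))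

sum-zero : ∀ n {f} → (∀ a → a < n → f a ≋ []) → sumBelow n f ≋ []
sum-zero zero    e = ≋-refl
sum-zero (suc n) e = ++-cong (e 0 (s≤s z≤n)) (sum-zero n (λ a a<n → e (suc a) (s≤s a<n)))

sum-split : ∀ n f g → sumBelow n (λ a → f a ++ g a) ≋ sumBelow n f ++ sumBelow n g
sum-split zero    f g = ≋-refl
sum-split (suc n) f g =
  ≋-trans (++-congˡ _ (sum-split n (f ∘ suc) (g ∘ suc)))
          (++-interchange (f 0) (g 0) (sumBelow n (f ∘ suc)) (sumBelow n (g ∘ suc)))

sum-extend : ∀ m n {f} → m ≤ n → (∀ a → m ≤ a → a < n → f a ≋ []) → sumBelow m f ≋ sumBelow n f
sum-extend zero    n       m≤n e = ≋-sym (sum-zero n (λ a a<n → e a z≤n a<n))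
sum-extend (suc m) (suc n) {f} (s≤s m≤n) e =
  ++-congˡ _ (sum-extend m n {f ∘ suc} m≤n (λ a m≤a a<n → e (suc a) (s≤s m≤a) (s≤s a<n)))

sum-swap : ∀ m n (F : ℕ → ℕ → Poly) → (∑[ a < m ] ∑[ b < n ] F a b) ≋ (∑[ b < n ] ∑[ a < m ] F a b)
sum-swap zero    n F = ≋-sym (sum-zero n (λ _ _ → ≋-refl))
sum-swap (suc m) n F =
  ≋-trans (++-congˡ _ (sum-swap m n (F ∘ suc)))
          (≋-sym (sum-split n (F 0) (λ b → ∑[ a < m ] F (suc a) b)))

sum-triangle : ∀ m (F : ℕ → ℕ → Poly) →
               (∑[ a < m ] ∑[ i < suc a ] F a i) ≋ (∑[ i < m ] ∑[ b < m ∸ i ] F (i + b) i)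
sum-triangle zero    F = ≋-refl
sum-triangle (suc m) F = begin
  (∑[ a < suc m ] ∑[ i < suc a ] F a i)                        ≡⟨ sum-last m _ ⟩
  (∑[ a < m ] ∑[ i < suc a ] F a i) ++ LastRow                  ≈⟨ ++-congʳ LastRow (sum-triangle m F) ⟩
  Rows m ++ LastRow                                            ≈⟨ ++-congʳ LastRow lastRowEmpty ⟩
  (∑[ i < suc m ] Row m i) ++ LastRow                          ≈⟨ sum-split (suc m) (Row m) (F m) ⟨
  (∑[ i < suc m ] (Row m i ++ F m i))                          ≡⟨ sum-cong-≡ (suc m) extendRow ⟩
  Rows (suc m)                                                 ∎
  where
  open ≋-Reasoning
  Row : ℕ → ℕ → Poly
  Row m i = ∑[ b < m ∸ i ] F (i + b) i
  Rows : ℕ → Poly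
  Rows m = ∑[ i < m ] Row m i
  LastRow : Poly
  LastRow = ∑[ i < suc m ] F m i
  lastRowEmpty : Rows m ≋ (∑[ i < suc m ] Row m i)
  lastRowEmpty = ≡⇒≋ (sym (trans (sum-last m (Row m))
                            (trans (cong (λ n → Rows m ++ (∑[ b < n ] F (m + b) m)) (ℕ.n∸n≡0 m))
                                   (List.++-identityʳ (Rows m)))))
  extendRow : ∀ i → i < suc m → Row m i ++ F m i ≡ Row (suc m) i
  extendRow i (s≤s i≤m) =
    trans (cong (λ a → Row m i ++ F a i) (sym (ℕ.m+[n∸m]≡n i≤m)))
          (trans (sym (sum-last (m ∸ i) (λ b → F (i + b) i)))
                 (cong (λ n → ∑[ b < n ] F (i + b) i) (sym (ℕ.+-∸-assoc 1 i≤m))))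

lmul-sum : ∀ c d v n f → lmul c d v (sumBelow n f) ≡ ∑[ a < n ] lmul c d v (f a)
lmul-sum c d v n f =
  trans (sym (List.concat-map (applyUpTo f n))) (cong concat (List.map-applyUpTo f (lmul c d v) n))

module _ (op : Word → Word → Poly) where

  bilin-sumˡ : ∀ n f Q → bilin op (sumBelow n f) Q ≡ ∑[ a < n ] bilin op (f a) Q
  bilin-sumˡ n f Q =
    trans (concatMap-concat _ (applyUpTo f n)) (cong concat (List.map-applyUpTo f (λ P → bilin op P Q) n))

  bilin-sumʳ : ∀ P n f → bilin op P (sumBelow n f) ≋ ∑[ a < n ] bilin op P (f a)
  bilin-sumʳ P zero    f = ≡⇒≋ (bilin-zeroʳ op P)
  bilin-sumʳ P (suc n) f =
    ≋-trans (bilin-++ʳ op P (f 0) (sumBelow n (f ∘ suc))) (++-congˡ _ (bilin-sumʳ P n (f ∘ suc)))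

consIdx : ℕ → List ℕ × ℕ → List ℕ × ℕ
consIdx p (is , c) = (p ∷ is , c)

wordsOf : List (List ℕ) → Poly
wordsOf = map (λ ks → (1ℚ , 0 , fromIdx ks))

harmIdxPair : List ℕ × ℕ → List ℕ × ℕ → Poly
harmIdxPair (is , zero)  (js , zero)  = wordsOf (harmIdx is js)
harmIdxPair (is , zero)  (js , suc _) = []
harmIdxPair (is , suc _) (js , _)     = []

harmW-harmIdxPair : ∀ v w → harmW v w ≡ harmIdxPair (toIdx v) (toIdx w)
harmW-harmIdxPair v w with toIdx v | toIdx w
... | is , zero  | js , zero  = refl
... | is , zero  | js , suc _ = refl
... | is , suc _ | js , zero  = refl
... | is , suc _ | js , suc _ = refl

toIdx'-replicate : ∀ p c w → toIdx' c (replicate p x ++ w) ≡ toIdx' (p + c) w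
toIdx'-replicate zero    c w = refl
toIdx'-replicate (suc p) c w = trans (toIdx'-replicate p (suc c) w) (cong (λ n → toIdx' n w) (ℕ.+-suc p c))

toIdx-zw : ∀ p u → toIdx (zw (suc p) ++ u) ≡ consIdx (suc p) (toIdx u)
toIdx-zw p u =
  trans (cong (toIdx' 0) (List.++-assoc (replicate p x) (y ∷ []) u))
        (trans (toIdx'-replicate p 0 (y ∷ u)) (cong (λ n → toIdx' n (y ∷ u)) (ℕ.+-identityʳ p)))

wordsOf-∷ : ∀ p X → wordsOf (map (p ∷_) X) ≡ lmul 1ℚ 0 (zw p) (wordsOf X)
wordsOf-∷ p X =
  trans (sym (List.map-∘ X))
        (trans (List.map-cong (λ ks → cong (_, 0 , zw p ++ fromIdx ks) (sym (ℚ.*-identityˡ 1ℚ))) X) (List.map-∘ X))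

harmIdxPair-∷-∷ : ∀ p q A B → harmIdxPair (consIdx p A) (consIdx q B) ≡
  lmul 1ℚ 0 (zw p) (harmIdxPair A (consIdx q B)) ++
  (lmul 1ℚ 0 (zw q) (harmIdxPair (consIdx p A) B) ++ lmul 1ℚ 0 (zw (p + q)) (harmIdxPair A B))
harmIdxPair-∷-∷ p q (is , zero) (js , zero) =
  trans (List.map-++ _ (map (p ∷_) (harmIdx is (q ∷ js))) _)
        (cong₂ _++_ (wordsOf-∷ p (harmIdx is (q ∷ js)))
                    (trans (List.map-++ _ (map (q ∷_) (harmIdx (p ∷ is) js)) _)
                           (cong₂ _++_ (wordsOf-∷ q (harmIdx (p ∷ is) js)) (wordsOf-∷ (p + q) (harmIdx is js)))))
harmIdxPair-∷-∷ p q (is , zero)  (js , suc _) = refl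
harmIdxPair-∷-∷ p q (is , suc _) (js , zero)  = refl
harmIdxPair-∷-∷ p q (is , suc _) (js , suc _) = refl

harmIdxPair-∷-ε : ∀ p A → harmIdxPair (consIdx p A) ([] , 0) ≡ lmul 1ℚ 0 (zw p) (harmIdxPair A ([] , 0))
harmIdxPair-∷-ε p ([]       , zero)  = wordsOf-∷ p ([] ∷ [])
harmIdxPair-∷-ε p ((a ∷ is) , zero)  = wordsOf-∷ p ((a ∷ is) ∷ [])
harmIdxPair-∷-ε p (is       , suc _) = refl

harmIdxPair-ε-∷ : ∀ q B → harmIdxPair ([] , 0) (consIdx q B) ≡ lmul 1ℚ 0 (zw q) (harmIdxPair ([] , 0) B)
harmIdxPair-ε-∷ q (js , zero)  = wordsOf-∷ q (js ∷ [])
harmIdxPair-ε-∷ q (js , suc _) = refl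

harmW-zw-zw : ∀ p q u u' → harmW (zw (suc p) ++ u) (zw (suc q) ++ u') ≡
  lmul 1ℚ 0 (zw (suc p)) (harmW u (zw (suc q) ++ u')) ++
  (lmul 1ℚ 0 (zw (suc q)) (harmW (zw (suc p) ++ u) u') ++ lmul 1ℚ 0 (zw (suc p + suc q)) (harmW u u'))
harmW-zw-zw p q u u'
  rewrite harmW-harmIdxPair (zw (suc p) ++ u) (zw (suc q) ++ u') | harmW-harmIdxPair u (zw (suc q) ++ u')
        | harmW-harmIdxPair (zw (suc p) ++ u) u' | harmW-harmIdxPair u u' | toIdx-zw p u | toIdx-zw q u'
  = harmIdxPair-∷-∷ (suc p) (suc q) (toIdx u) (toIdx u')

harmW-zw-ε : ∀ p u → harmW (zw (suc p) ++ u) [] ≡ lmul 1ℚ 0 (zw (suc p)) (harmW u [])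
harmW-zw-ε p u rewrite harmW-harmIdxPair (zw (suc p) ++ u) [] | harmW-harmIdxPair u [] | toIdx-zw p u =
  harmIdxPair-∷-ε (suc p) (toIdx u)

harmW-ε-zw : ∀ q u' → harmW [] (zw (suc q) ++ u') ≡ lmul 1ℚ 0 (zw (suc q)) (harmW [] u')
harmW-ε-zw q u' rewrite harmW-harmIdxPair [] (zw (suc q) ++ u') | harmW-harmIdxPair [] u' | toIdx-zw q u' =
  harmIdxPair-ε-∷ (suc q) (toIdx u')

bilin-map-map : ∀ op g h X Y → bilin op (map g X) (map h Y) ≡ sumProducts (λ t t' → termProduct op (g t) (h t')) X Y
bilin-map-map op g h X Y =
  trans (sumProducts-mapˡ (termProduct op) g X (map h Y)) (sumProducts-mapʳ _ h X Y)

lmul-factor : ∀ c d c₁ d₁ v c₁' d₁' H → c ≡ c₁ *ℚ c₁' → d ≡ d₁ + d₁' →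
              lmul c d [] (lmul 1ℚ 0 v H) ≡ lmul c₁ d₁ v (lmul c₁' d₁' [] H)
lmul-factor c d c₁ d₁ v c₁' d₁' H refl refl = begin
  lmul c d [] (lmul 1ℚ 0 v H)
    ≡⟨ lmul-lmul c d [] 1ℚ 0 v H ⟩
  lmul (c *ℚ 1ℚ) (d + 0) v H
    ≡⟨ lmul-≡ H (ℚ.*-identityʳ c) (ℕ.+-identityʳ d) (sym (List.++-identityʳ v)) ⟩
  lmul (c₁ *ℚ c₁') (d₁ + d₁') (v ++ []) H
    ≡⟨ lmul-lmul c₁ d₁ v c₁' d₁' [] H ⟨
  lmul c₁ d₁ v (lmul c₁' d₁' [] H) ∎
  where open ≡-Reasoning

module _ (p q : ℕ) (a : ℚ) (d : ℕ) (b : ℚ) (e : ℕ) where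
  private
    zp = zw (suc p)
    zq = zw (suc q)
    zpq = zw (suc p + suc q)
    ×p = mulTerm a d zp
    ×q = mulTerm b e zq

  termProduct-zw-zw : ∀ t t' →
    termProduct harmW (×p t) (×q t') ≡
    lmul a d zp (termProduct harmW t (×q t')) ++
    (lmul b e zq (termProduct harmW (×p t) t') ++ lmul (a *ℚ b) (d + e) zpq (termProduct harmW t t'))
  termProduct-zw-zw (r , l , u) (r' , l' , u') = begin
    lmul K D [] (harmW (zp ++ u) (zq ++ u'))
      ≡⟨ cong (lmul K D []) (harmW-zw-zw p q u u') ⟩
    lmul K D [] (lmul 1ℚ 0 zp HA ++ (lmul 1ℚ 0 zq HB ++ lmul 1ℚ 0 zpq HC))
      ≡⟨ trans (List.map-++ _ (lmul 1ℚ 0 zp HA) _)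
               (cong (lmul K D [] (lmul 1ℚ 0 zp HA) ++_) (List.map-++ _ (lmul 1ℚ 0 zq HB) _)) ⟩
    lmul K D [] (lmul 1ℚ 0 zp HA) ++ (lmul K D [] (lmul 1ℚ 0 zq HB) ++ lmul K D [] (lmul 1ℚ 0 zpq HC))
      ≡⟨ cong₂ _++_ (lmul-factor K D a d zp (r *ℚ (b *ℚ r')) (l + (e + l')) HA (coeffA a r b r') (degA d l e l'))
           (cong₂ _++_ (lmul-factor K D b e zq ((a *ℚ r) *ℚ r') ((d + l) + l') HB (coeffB a r b r') (degB d l e l'))
                       (lmul-factor K D (a *ℚ b) (d + e) zpq (r *ℚ r') (l + l') HC (coeffC a r b r') (degC d l e l'))) ⟩
    lmul a d zp (lmul (r *ℚ (b *ℚ r')) (l + (e + l')) [] HA) ++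
    (lmul b e zq (lmul ((a *ℚ r) *ℚ r') ((d + l) + l') [] HB) ++ lmul (a *ℚ b) (d + e) zpq (lmul (r *ℚ r') (l + l') [] HC)) ∎
    where
    open ≡-Reasoning
    open +-*-Solver
    K = (a *ℚ r) *ℚ (b *ℚ r')
    D = (d + l) + (e + l')
    HA = harmW u (zq ++ u')
    HB = harmW (zp ++ u) u'
    HC = harmW u u'
    coeffA : ∀ a r b r' → (a *ℚ r) *ℚ (b *ℚ r') ≡ a *ℚ (r *ℚ (b *ℚ r'))
    coeffA = solve 4 (λ a r b r' → (a :* r) :* (b :* r') := a :* (r :* (b :* r'))) refl
    coeffB : ∀ a r b r' → (a *ℚ r) *ℚ (b *ℚ r') ≡ b *ℚ ((a *ℚ r) *ℚ r')
    coeffB = solve 4 (λ a r b r' → (a :* r) :* (b :* r') := b :* ((a :* r) :* r')) refl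
    coeffC : ∀ a r b r' → (a *ℚ r) *ℚ (b *ℚ r') ≡ (a *ℚ b) *ℚ (r *ℚ r')
    coeffC = solve 4 (λ a r b r' → (a :* r) :* (b :* r') := (a :* b) :* (r :* r')) refl
    degA : ∀ d l e l' → (d + l) + (e + l') ≡ d + (l + (e + l'))
    degA = ℕ-Ring.solve-∀
    degB : ∀ d l e l' → (d + l) + (e + l') ≡ e + ((d + l) + l')
    degB = ℕ-Ring.solve-∀
    degC : ∀ d l e l' → (d + l) + (e + l') ≡ (d + e) + (l + l')
    degC = ℕ-Ring.solve-∀

  ⋆-zw-zw : ∀ X Y →
    lmul a d zp X ⋆ lmul b e zq Y ≋
    lmul a d zp (X ⋆ lmul b e zq Y) ++ (lmul b e zq (lmul a d zp X ⋆ Y) ++ lmul (a *ℚ b) (d + e) zpq (X ⋆ Y))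
  ⋆-zw-zw X Y = begin
    lmul a d zp X ⋆ lmul b e zq Y
      ≡⟨ bilin-map-map harmW ×p ×q X Y ⟩
    sumProducts (λ t t' → termProduct harmW (×p t) (×q t')) X Y
      ≡⟨ sumProducts-≡ X Y termProduct-zw-zw ⟩
    sumProducts (λ t t' → FA t t' ++ (FB t t' ++ FC t t')) X Y
      ≈⟨ ≋-trans (sumProducts-split FA _ X Y) (++-congˡ _ (sumProducts-split FB FC X Y)) ⟩
    sumProducts FA X Y ++ (sumProducts FB X Y ++ sumProducts FC X Y)
      ≡⟨ cong₂ _++_ (sym (trans (cong (lmul a d zp) (sumProducts-mapʳ (termProduct harmW) ×q X Y))
                                (lmul-sumProducts a d zp _ X Y)))
                    (cong₂ _++_ (sym (trans (cong (lmul b e zq) (sumProducts-mapˡ (termProduct harmW) ×p X Y))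
                                            (lmul-sumProducts b e zq _ X Y)))
                                (sym (lmul-sumProducts (a *ℚ b) (d + e) zpq (termProduct harmW) X Y))) ⟩
    lmul a d zp (X ⋆ lmul b e zq Y) ++ (lmul b e zq (lmul a d zp X ⋆ Y) ++ lmul (a *ℚ b) (d + e) zpq (X ⋆ Y)) ∎
    where
    open ≋-Reasoning
    FA FB FC : Term → Term → Poly
    FA t t' = lmul a d zp (termProduct harmW t (×q t'))
    FB t t' = lmul b e zq (termProduct harmW (×p t) t')
    FC t t' = lmul (a *ℚ b) (d + e) zpq (termProduct harmW t t')

module _ (p : ℕ) (a : ℚ) (d : ℕ) where
  private
    zp = zw (suc p)

  ⋆-one : ∀ X → lmul a d zp X ⋆ oneP ≡ lmul a d zp (X ⋆ oneP)
  ⋆-one X =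
    trans (sumProducts-mapˡ (termProduct harmW) (mulTerm a d zp) X oneP)
          (trans (List.concatMap-cong (λ t → cong (_++ []) (termwise t)) X)
                 (sym (lmul-sumProducts a d zp (termProduct harmW) X oneP)))
    where
    termwise : ∀ t → termProduct harmW (mulTerm a d zp t) (1ℚ , 0 , []) ≡ lmul a d zp (termProduct harmW t (1ℚ , 0 , []))
    termwise (r , l , u) =
      trans (cong (lmul ((a *ℚ r) *ℚ 1ℚ) ((d + l) + 0) []) (harmW-zw-ε p u))
            (lmul-factor ((a *ℚ r) *ℚ 1ℚ) ((d + l) + 0) a d zp (r *ℚ 1ℚ) (l + 0) (harmW u [])
               (ℚ.*-assoc a r 1ℚ) (ℕ.+-assoc d l 0))

  one-⋆ : ∀ Y → oneP ⋆ lmul a d zp Y ≡ lmul a d zp (oneP ⋆ Y)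
  one-⋆ Y =
    trans (sumProducts-mapʳ (termProduct harmW) (mulTerm a d zp) oneP Y)
          (trans (cong (_++ []) (List.concatMap-cong termwise Y))
                 (sym (lmul-sumProducts a d zp (termProduct harmW) oneP Y)))
    where
    termwise : ∀ t → termProduct harmW (1ℚ , 0 , []) (mulTerm a d zp t) ≡ lmul a d zp (termProduct harmW (1ℚ , 0 , []) t)
    termwise (r , l , u) =
      trans (cong (lmul (1ℚ *ℚ (a *ℚ r)) (0 + (d + l)) []) (harmW-ε-zw p u))
            (lmul-factor (1ℚ *ℚ (a *ℚ r)) (0 + (d + l)) a d zp (1ℚ *ℚ r) (0 + l) (harmW [] u)
               (trans (ℚ.*-identityˡ (a *ℚ r)) (cong (a *ℚ_) (sym (ℚ.*-identityˡ r)))) refl)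

concatW : Word → Word → Poly
concatW v w = word (v ++ w)

·-monomial : ∀ q i v P → ((q , i , v) ∷ []) · P ≡ lmul q i v P
·-monomial q i v P = trans (List.++-identityʳ _) (termwise P)
  where
  termwise : ∀ P → concatMap (termProduct concatW (q , i , v)) P ≡ lmul q i v P
  termwise []                  = refl
  termwise ((q' , i' , v') ∷ P) =
    cong₂ _∷_ (cong₂ _,_ (ℚ.*-identityʳ (q *ℚ q')) (cong (_, v ++ v') (ℕ.+-identityʳ (i + i')))) (termwise P)

St-∷ : ∀ a {w} → w ≢ [] → St (a ∷ w) ≡ σL a · St w
St-∷ a {[]}    w≢[] = ⊥-elim (w≢[] refl)
St-∷ a {b ∷ w} _    = refl

St-x∷ : ∀ {w} → w ≢ [] → St (x ∷ w) ≡ lmul 1ℚ 0 (x ∷ []) (St w)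
St-x∷ {w} w≢[] = trans (St-∷ x w≢[]) (·-monomial 1ℚ 0 (x ∷ []) (St w))

St-y∷ : ∀ {w} → w ≢ [] → St (y ∷ w) ≡ lmul 1ℚ 1 (x ∷ []) (St w) ++ lmul 1ℚ 0 (y ∷ []) (St w)
St-y∷ {w} w≢[] =
  trans (St-∷ y w≢[])
        (trans (bilin-++ˡ concatW ((1ℚ , 1 , x ∷ []) ∷ []) ((1ℚ , 0 , y ∷ []) ∷ []) (St w))
               (cong₂ _++_ (·-monomial 1ℚ 1 (x ∷ []) (St w)) (·-monomial 1ℚ 0 (y ∷ []) (St w))))

++-≢[] : ∀ (v : Word) {w} → w ≢ [] → v ++ w ≢ []
++-≢[] v {w} w≢[] = w≢[] ∘ List.++-conicalʳ v w

St-replicate-x : ∀ p {w} → w ≢ [] → St (replicate p x ++ w) ≡ lmul 1ℚ 0 (replicate p x) (St w)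
St-replicate-x zero    {w} w≢[] = sym (lmul-identity (St w))
St-replicate-x (suc p) {w} w≢[] = begin
  St (x ∷ replicate p x ++ w)
    ≡⟨ St-x∷ (++-≢[] (replicate p x) w≢[]) ⟩
  lmul 1ℚ 0 (x ∷ []) (St (replicate p x ++ w))
    ≡⟨ cong (lmul 1ℚ 0 (x ∷ [])) (St-replicate-x p w≢[]) ⟩
  lmul 1ℚ 0 (x ∷ []) (lmul 1ℚ 0 (replicate p x) (St w))
    ≡⟨ lmul-lmul 1ℚ 0 (x ∷ []) 1ℚ 0 (replicate p x) (St w) ⟩
  lmul (1ℚ *ℚ 1ℚ) 0 (replicate (suc p) x) (St w)
    ≡⟨ cong (λ c → lmul c 0 (replicate (suc p) x) (St w)) (ℚ.*-identityˡ 1ℚ) ⟩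
  lmul 1ℚ 0 (replicate (suc p) x) (St w) ∎
  where open ≡-Reasoning

replicate-x-++-zw : ∀ a b → replicate a x ++ zw (suc b) ≡ zw (suc (a + b))
replicate-x-++-zw zero    b = refl
replicate-x-++-zw (suc a) b = cong (x ∷_) (replicate-x-++-zw a b)

zw-++-≢[] : ∀ p w → zw p ++ w ≢ []
zw-++-≢[] p w eq with List.++-conicalʳ (replicate (p ∸ 1) x) (y ∷ []) (List.++-conicalˡ (zw p) w eq)
... | ()

replicate-x-∷ʳ : ∀ p → replicate p x ++ x ∷ [] ≡ replicate (suc p) x
replicate-x-∷ʳ zero    = refl
replicate-x-∷ʳ (suc p) = cong (x ∷_) (replicate-x-∷ʳ p)

St-zw : ∀ p {w} → w ≢ [] →
        St (zw (suc p) ++ w) ≡ lmul 1ℚ 1 (replicate (suc p) x) (St w) ++ lmul 1ℚ 0 (zw (suc p)) (St w)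
St-zw p {w} w≢[] = begin
  St ((replicate p x ++ y ∷ []) ++ w)
    ≡⟨ cong St (List.++-assoc (replicate p x) (y ∷ []) w) ⟩
  St (replicate p x ++ y ∷ w)
    ≡⟨ St-replicate-x p (λ ()) ⟩
  lmul 1ℚ 0 (replicate p x) (St (y ∷ w))
    ≡⟨ cong (lmul 1ℚ 0 (replicate p x)) (St-y∷ w≢[]) ⟩
  lmul 1ℚ 0 (replicate p x) (lmul 1ℚ 1 (x ∷ []) (St w) ++ lmul 1ℚ 0 (y ∷ []) (St w))
    ≡⟨ List.map-++ _ (lmul 1ℚ 1 (x ∷ []) (St w)) _ ⟩
  lmul 1ℚ 0 (replicate p x) (lmul 1ℚ 1 (x ∷ []) (St w)) ++ lmul 1ℚ 0 (replicate p x) (lmul 1ℚ 0 (y ∷ []) (St w))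
    ≡⟨ cong₂ _++_ (trans (lmul-lmul 1ℚ 0 (replicate p x) 1ℚ 1 (x ∷ []) (St w))
                         (lmul-≡ (St w) (ℚ.*-identityˡ 1ℚ) refl (replicate-x-∷ʳ p)))
                  (trans (lmul-lmul 1ℚ 0 (replicate p x) 1ℚ 0 (y ∷ []) (St w))
                         (lmul-≡ (St w) (ℚ.*-identityˡ 1ℚ) refl refl)) ⟩
  lmul 1ℚ 1 (replicate (suc p) x) (St w) ++ lmul 1ℚ 0 (zw (suc p)) (St w) ∎
  where open ≡-Reasoning

module GeometricSeries (F : PS) (F-zero : F 0 ≡ zeroP) where

  F-zero-· : ∀ X → F 0 · X ≡ []
  F-zero-· X = cong (_· X) F-zero

  powPS-suc : ∀ m j → powPS F (suc m) j ≡ ∑[ a < suc j ] F a · powPS F m (j ∸ a)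
  powPS-suc m j = concat-map-upTo (λ a → F a · powPS F m (j ∸ a)) (suc j)

  powPS-vanishes : ∀ m j → j < m → powPS F m j ≋ []
  powPS-vanishes (suc m) j (s≤s j≤m) = ≋-trans (≡⇒≋ (powPS-suc m j)) (sum-zero (suc j) term)
    where
    term : ∀ a → a < suc j → F a · powPS F m (j ∸ a) ≋ []
    term zero    _ = ≡⇒≋ (F-zero-· (powPS F m j))
    term (suc a) (s≤s a<j) =
      bilin-vanishesʳ concatW (F (suc a))
        (powPS-vanishes m (j ∸ suc a) (ℕ.<-≤-trans (ℕ.∸-monoʳ-< (s≤s z≤n) a<j) j≤m))

  geomPS-zero : geomPS F 0 ≋ oneP
  geomPS-zero = ≡⇒≋ (List.++-identityʳ oneP)

  geomPS-suc : ∀ n → geomPS F (suc n) ≋ ∑[ a < suc (suc n) ] F a · geomPS F (suc n ∸ a)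
  geomPS-suc n = begin
    geomPS F (suc n)
      ≡⟨ concat-map-upTo (λ m → powPS F m (suc n)) (suc (suc n)) ⟩
    (∑[ m < suc n ] powPS F (suc m) (suc n))
      ≡⟨ sum-cong-≡ (suc n) (λ m _ → powPS-suc m (suc n)) ⟩
    (∑[ m < suc n ] ∑[ a < suc (suc n) ] F a · powPS F m (suc n ∸ a))
      ≈⟨ sum-swap (suc n) (suc (suc n)) (λ m a → F a · powPS F m (suc n ∸ a)) ⟩
    (∑[ a < suc (suc n) ] ∑[ m < suc n ] F a · powPS F m (suc n ∸ a))
      ≈⟨ sum-cong (suc (suc n)) (λ a _ → column a) ⟩
    (∑[ a < suc (suc n) ] F a · geomPS F (suc n ∸ a)) ∎
    where
    open ≋-Reasoning
    column : ∀ a → (∑[ m < suc n ] F a · powPS F m (suc n ∸ a)) ≋ F a · geomPS F (suc n ∸ a)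
    column zero    =
      ≋-trans (sum-zero (suc n) (λ m _ → ≡⇒≋ (F-zero-· (powPS F m (suc n)))))
              (≡⇒≋ (sym (F-zero-· (geomPS F (suc n)))))
    column (suc a) = ≋-sym (begin
      F (suc a) · geomPS F (n ∸ a)
        ≡⟨ cong (F (suc a) ·_) (concat-map-upTo (λ m → powPS F m (n ∸ a)) (suc (n ∸ a))) ⟩
      F (suc a) · (∑[ m < suc (n ∸ a) ] powPS F m (n ∸ a))
        ≈⟨ bilin-sumʳ concatW (F (suc a)) (suc (n ∸ a)) (λ m → powPS F m (n ∸ a)) ⟩
      (∑[ m < suc (n ∸ a) ] F (suc a) · powPS F m (n ∸ a))
        ≈⟨ sum-extend (suc (n ∸ a)) (suc n) (s≤s (ℕ.m∸n≤m n a))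
                      (λ m n∸a<m _ → bilin-vanishesʳ concatW (F (suc a)) (powPS-vanishes m (n ∸ a) n∸a<m)) ⟩
      (∑[ m < suc n ] F (suc a) · powPS F m (n ∸ a)) ∎)

  geomPS-unique : ∀ (G : PS) → G 0 ≋ oneP → (∀ n → G (suc n) ≋ ∑[ a < suc (suc n) ] F a · G (suc n ∸ a)) →
                  ∀ n → G n ≋ geomPS F n
  geomPS-unique G G-zero G-suc n = below n n ℕ.≤-refl
    where
    below : ∀ n j → j ≤ n → G j ≋ geomPS F j
    below zero    zero    z≤n = ≋-trans G-zero (≋-sym geomPS-zero)
    below (suc n) j j≤1+n with ℕ.m≤n⇒m<n∨m≡n j≤1+n
    ... | inj₁ (s≤s j≤n) = below n j j≤n
    ... | inj₂ refl = begin
      G (suc n)                                                 ≈⟨ G-suc n ⟩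
      (∑[ a < suc (suc n) ] F a · G (suc n ∸ a))                ≈⟨ sum-cong (suc (suc n)) (λ a _ → term a) ⟩
      (∑[ a < suc (suc n) ] F a · geomPS F (suc n ∸ a))         ≈⟨ geomPS-suc n ⟨
      geomPS F (suc n)                                          ∎
      where
      open ≋-Reasoning
      term : ∀ a → F a · G (suc n ∸ a) ≋ F a · geomPS F (suc n ∸ a)
      term zero    = ≡⇒≋ (trans (F-zero-· (G (suc n))) (sym (F-zero-· (geomPS F (suc n)))))
      term (suc a) = bilin-congʳ concatW (F (suc a)) (below n (n ∸ a) (ℕ.m∸n≤m n a))

-- S a, C b and L n are the coefficients of u^a, u^b, u^n in Ŝ, Ĉ and Ŝ ⋆ Ĉ (for k = suc k');
-- Z i is z_((i+1)k).
module Coefficients (k' : ℕ) where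
  private
    k = suc k'

  z : Word
  z = zw k

  Z : ℕ → Word
  Z i = zw (suc i * k)

  S : ℕ → Poly
  S a = St (zpow k a)

  C : ℕ → Poly
  C = geomMinus k

  L : ℕ → Poly
  L n = ∑[ a < suc n ] S a ⋆ C (n ∸ a)

  Z-zero : Z 0 ≡ z
  Z-zero = cong zw (ℕ.+-identityʳ k)

  replicate-x-++-Z : ∀ i → replicate k x ++ Z i ≡ Z (suc i)
  replicate-x-++-Z i =
    trans (replicate-x-++-zw k (k' + i * k)) (cong (zw ∘ suc) (sym (ℕ.+-suc k' (k' + i * k))))

  Z-merge : ∀ i → zw (suc (k' + i * k) + k) ≡ Z (suc i)
  Z-merge i = cong zw (index k' i)
    where
    index : ∀ k' i → suc (k' + i * suc k') + suc k' ≡ suc (suc i) * suc k'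
    index = ℕ-Ring.solve-∀

  S-one : S 1 ≡ lmul 1ℚ 0 z oneP
  S-one = begin
    St (z ++ [])
      ≡⟨ cong St (List.++-identityʳ z) ⟩
    St (replicate k' x ++ y ∷ [])
      ≡⟨ St-replicate-x k' (λ ()) ⟩
    lmul 1ℚ 0 (replicate k' x) (word (y ∷ []))
      ≡⟨ cong (λ w → (1ℚ *ℚ 1ℚ , 0 , w) ∷ []) (sym (List.++-identityʳ z)) ⟩
    lmul 1ℚ 0 z oneP ∎
    where open ≡-Reasoning

  S-suc : ∀ m → S (suc m) ≋ ∑[ i < suc m ] lmul 1ℚ i (Z i) (S (m ∸ i))
  S-suc zero = ≡⇒≋ (trans S-one (trans (cong (λ w → lmul 1ℚ 0 w oneP) (sym Z-zero)) (sym (List.++-identityʳ _))))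
  S-suc (suc m) = begin
    St (z ++ zpow k (suc m))
      ≡⟨ St-zw k' (zw-++-≢[] k (zpow k m)) ⟩
    lmul 1ℚ 1 (replicate k x) (S (suc m)) ++ lmul 1ℚ 0 z (S (suc m))
      ≈⟨ ++-comm (lmul 1ℚ 1 (replicate k x) (S (suc m))) (lmul 1ℚ 0 z (S (suc m))) ⟩
    lmul 1ℚ 0 z (S (suc m)) ++ lmul 1ℚ 1 (replicate k x) (S (suc m))
      ≈⟨ ++-cong (≡⇒≋ (cong (λ w → lmul 1ℚ 0 w (S (suc m))) (sym Z-zero)))
                 (lmul-cong 1ℚ 1 (replicate k x) (S-suc m)) ⟩
    lmul 1ℚ 0 (Z 0) (S (suc m)) ++ lmul 1ℚ 1 (replicate k x) (∑[ i < suc m ] lmul 1ℚ i (Z i) (S (m ∸ i)))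
      ≡⟨ cong (lmul 1ℚ 0 (Z 0) (S (suc m)) ++_)
              (trans (lmul-sum 1ℚ 1 (replicate k x) (suc m) (λ i → lmul 1ℚ i (Z i) (S (m ∸ i))))
                     (sum-cong-≡ (suc m) (λ i _ → advance i))) ⟩
    (∑[ i < suc (suc m) ] lmul 1ℚ i (Z i) (S (suc m ∸ i))) ∎
    where
    open ≋-Reasoning
    advance : ∀ i → lmul 1ℚ 1 (replicate k x) (lmul 1ℚ i (Z i) (S (m ∸ i))) ≡ lmul 1ℚ (suc i) (Z (suc i)) (S (m ∸ i))
    advance i = trans (lmul-lmul 1ℚ 1 (replicate k x) 1ℚ i (Z i) (S (m ∸ i)))
                      (lmul-≡ (S (m ∸ i)) (ℚ.*-identityˡ 1ℚ) refl (replicate-x-++-Z i))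

  C-zero : C 0 ≡ oneP
  C-zero = cong (λ q → (q , 0 , []) ∷ []) (ℚ.*-identityˡ 1ℚ)

  C-suc : ∀ b → C (suc b) ≡ lmul (- 1ℚ) 0 z (C b)
  C-suc b = cong (λ q → (q , 0 , z ++ zpow k b) ∷ [])
                 (solve 1 (λ s → (:- s) :* con 1ℚ := (:- con 1ℚ) :* (s :* con 1ℚ)) refl (signQ b))
    where open +-*-Solver

  S⋆C-suc-zero : ∀ a → S (suc a) ⋆ C 0 ≋ ∑[ i < suc a ] lmul 1ℚ i (Z i) (S (a ∸ i) ⋆ C 0)
  S⋆C-suc-zero a = begin
    S (suc a) ⋆ C 0
      ≈⟨ bilin-cong harmW (S-suc a) (≡⇒≋ C-zero) ⟩
    (∑[ i < suc a ] lmul 1ℚ i (Z i) (S (a ∸ i))) ⋆ oneP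
      ≡⟨ bilin-sumˡ harmW (suc a) (λ i → lmul 1ℚ i (Z i) (S (a ∸ i))) oneP ⟩
    (∑[ i < suc a ] lmul 1ℚ i (Z i) (S (a ∸ i)) ⋆ oneP)
      ≡⟨ sum-cong-≡ (suc a) (λ i _ → trans (⋆-one (k' + i * k) 1ℚ i (S (a ∸ i)))
                                             (cong (λ Y → lmul 1ℚ i (Z i) (S (a ∸ i) ⋆ Y)) (sym C-zero))) ⟩
    (∑[ i < suc a ] lmul 1ℚ i (Z i) (S (a ∸ i) ⋆ C 0)) ∎
    where open ≋-Reasoning

  S⋆C-zero-suc : ∀ b → S 0 ⋆ C (suc b) ≡ lmul (- 1ℚ) 0 z (S 0 ⋆ C b)
  S⋆C-zero-suc b = trans (cong (oneP ⋆_) (C-suc b)) (one-⋆ k' (- 1ℚ) 0 (C b))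

  S⋆C-suc-suc : ∀ a b → S (suc a) ⋆ C (suc b) ≋
    (∑[ i < suc a ] lmul 1ℚ i (Z i) (S (a ∸ i) ⋆ C (suc b))) ++
    (lmul (- 1ℚ) 0 z (S (suc a) ⋆ C b) ++ (∑[ i < suc a ] lmul (- 1ℚ) i (Z (suc i)) (S (a ∸ i) ⋆ C b)))
  S⋆C-suc-suc a b = begin
    S (suc a) ⋆ C (suc b)
      ≈⟨ bilin-cong harmW (S-suc a) (≡⇒≋ (C-suc b)) ⟩
    (∑[ i < suc a ] X i) ⋆ lmul (- 1ℚ) 0 z (C b)
      ≡⟨ bilin-sumˡ harmW (suc a) X (lmul (- 1ℚ) 0 z (C b)) ⟩
    (∑[ i < suc a ] X i ⋆ lmul (- 1ℚ) 0 z (C b))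
      ≈⟨ sum-cong (suc a) (λ i _ → ⋆-zw-zw (k' + i * k) k' 1ℚ i (- 1ℚ) 0 (S (a ∸ i)) (C b)) ⟩
    (∑[ i < suc a ] (FA i ++ (FB i ++ FC i)))
      ≈⟨ sum-split (suc a) FA (λ i → FB i ++ FC i) ⟩
    (∑[ i < suc a ] FA i) ++ (∑[ i < suc a ] (FB i ++ FC i))
      ≈⟨ ++-congˡ (∑[ i < suc a ] FA i) (sum-split (suc a) FB FC) ⟩
    (∑[ i < suc a ] FA i) ++ ((∑[ i < suc a ] FB i) ++ (∑[ i < suc a ] FC i))
      ≈⟨ ++-cong (≡⇒≋ (sum-cong-≡ (suc a) (λ i _ → cong (λ Y → lmul 1ℚ i (Z i) (S (a ∸ i) ⋆ Y)) (sym (C-suc b)))))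
                 (++-cong ΣFB (≡⇒≋ (sum-cong-≡ (suc a) (λ i _ → lmul-≡ (S (a ∸ i) ⋆ C b)
                                                          (ℚ.*-identityˡ (- 1ℚ)) (ℕ.+-identityʳ i) (Z-merge i))))) ⟩
    (∑[ i < suc a ] lmul 1ℚ i (Z i) (S (a ∸ i) ⋆ C (suc b))) ++
    (lmul (- 1ℚ) 0 z (S (suc a) ⋆ C b) ++ (∑[ i < suc a ] lmul (- 1ℚ) i (Z (suc i)) (S (a ∸ i) ⋆ C b))) ∎
    where
    open ≋-Reasoning
    X FA FB FC : ℕ → Poly
    X i = lmul 1ℚ i (Z i) (S (a ∸ i))
    FA i = lmul 1ℚ i (Z i) (S (a ∸ i) ⋆ lmul (- 1ℚ) 0 z (C b))
    FB i = lmul (- 1ℚ) 0 z (X i ⋆ C b)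
    FC i = lmul (1ℚ *ℚ (- 1ℚ)) (i + 0) (zw (suc (k' + i * k) + k)) (S (a ∸ i) ⋆ C b)
    ΣFB : (∑[ i < suc a ] FB i) ≋ lmul (- 1ℚ) 0 z (S (suc a) ⋆ C b)
    ΣFB = ≋-trans (≡⇒≋ (trans (sym (lmul-sum (- 1ℚ) 0 z (suc a) (λ i → X i ⋆ C b)))
                              (cong (lmul (- 1ℚ) 0 z) (sym (bilin-sumˡ harmW (suc a) X (C b))))))
                  (lmul-cong (- 1ℚ) 0 z (bilin-congˡ harmW (C b) (≋-sym (S-suc a))))

  lmul-L : ∀ c i w {m n} (g : ℕ → ℕ) → m ≡ suc n → (∀ b → g b ≡ n ∸ b) →
           (∑[ b < m ] lmul c i w (S (i + b ∸ i) ⋆ C (g b))) ≡ lmul c i w (L n)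
  lmul-L c i w {n = n} g refl g≡ =
    trans (sum-cong-≡ (suc n) (λ b _ → cong₂ (λ a e → lmul c i w (S a ⋆ C e)) (ℕ.m+n∸m≡n i b) (g≡ b)))
          (sym (lmul-sum c i w (suc n) (λ b → S b ⋆ C (n ∸ b))))

  module Expansion (N : ℕ) where

    fromS fromC fromMerge : ℕ → Poly
    fromS a     = ∑[ i < suc a ] lmul 1ℚ i (Z i) (S (a ∸ i) ⋆ C (N ∸ a))
    fromC a     = lmul (- 1ℚ) 0 z (S a ⋆ C (N ∸ a))
    fromMerge a = ∑[ i < suc a ] lmul (- 1ℚ) i (Z (suc i)) (S (a ∸ i) ⋆ C (N ∸ suc a))

    L-suc-expand : L (suc N) ≋ (∑[ a < suc N ] fromS a) ++ ((∑[ a < suc N ] fromC a) ++ (∑[ a < N ] fromMerge a))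
    L-suc-expand = begin
      S 0 ⋆ C (suc N) ++ (∑[ a < suc N ] S (suc a) ⋆ C (N ∸ a))
        ≡⟨ cong₂ _++_ (S⋆C-zero-suc N) (sum-last N (λ a → S (suc a) ⋆ C (N ∸ a))) ⟩
      fromC 0 ++ ((∑[ a < N ] S (suc a) ⋆ C (N ∸ a)) ++ S (suc N) ⋆ C (N ∸ N))
        ≈⟨ ++-congˡ (fromC 0) (++-cong (sum-cong N inner) outer) ⟩
      fromC 0 ++ ((∑[ a < N ] (fromS a ++ (fromC (suc a) ++ fromMerge a))) ++ fromS N)
        ≈⟨ ++-congˡ (fromC 0) (++-congʳ (fromS N) (≋-trans (sum-split N fromS (λ a → fromC (suc a) ++ fromMerge a))
                                                          (++-congˡ (∑[ a < N ] fromS a) (sum-split N (fromC ∘ suc) fromMerge)))) ⟩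
      fromC 0 ++ (((∑[ a < N ] fromS a) ++ ((∑[ a < N ] fromC (suc a)) ++ (∑[ a < N ] fromMerge a))) ++ fromS N)
        ≈⟨ regroup (fromC 0) (∑[ a < N ] fromS a) (∑[ a < N ] fromC (suc a)) (∑[ a < N ] fromMerge a) (fromS N) ⟩
      ((∑[ a < N ] fromS a) ++ fromS N) ++ ((fromC 0 ++ (∑[ a < N ] fromC (suc a))) ++ (∑[ a < N ] fromMerge a))
        ≡⟨ cong (_++ ((∑[ a < suc N ] fromC a) ++ (∑[ a < N ] fromMerge a))) (sum-last N fromS) ⟨
      (∑[ a < suc N ] fromS a) ++ ((∑[ a < suc N ] fromC a) ++ (∑[ a < N ] fromMerge a)) ∎
      where
      open ≋-Reasoning
      inner : ∀ a → a < N → S (suc a) ⋆ C (N ∸ a) ≋ fromS a ++ (fromC (suc a) ++ fromMerge a)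
      inner a a<N rewrite ℕ.+-∸-assoc 1 a<N = S⋆C-suc-suc a (N ∸ suc a)
      outer : S (suc N) ⋆ C (N ∸ N) ≋ fromS N
      outer rewrite ℕ.n∸n≡0 N = S⋆C-suc-zero N
      regroup : ∀ P Q R T U → P ++ ((Q ++ (R ++ T)) ++ U) ≋ (Q ++ U) ++ ((P ++ R) ++ T)
      regroup = solve 5 (λ p q r t u → p ⊕ ((q ⊕ (r ⊕ t)) ⊕ u) ⊜ (q ⊕ u) ⊕ ((p ⊕ r) ⊕ t)) ≋-refl
        where open ++-Solver

    sum-fromS : (∑[ a < suc N ] fromS a) ≋ (∑[ i < suc N ] lmul 1ℚ i (Z i) (L (N ∸ i)))
    sum-fromS =
      ≋-trans (sum-triangle (suc N) (λ a i → lmul 1ℚ i (Z i) (S (a ∸ i) ⋆ C (N ∸ a))))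
              (≡⇒≋ (sum-cong-≡ (suc N) λ { i (s≤s i≤N) →
                 lmul-L 1ℚ i (Z i) (λ b → N ∸ (i + b)) (ℕ.+-∸-assoc 1 i≤N) (λ b → sym (ℕ.∸-+-assoc N i b)) }))

    sum-fromC : (∑[ a < suc N ] fromC a) ≡ lmul (- 1ℚ) 0 z (L N)
    sum-fromC = sym (lmul-sum (- 1ℚ) 0 z (suc N) (λ a → S a ⋆ C (N ∸ a)))

    sum-fromMerge : (∑[ a < N ] fromMerge a) ≋ (∑[ i < N ] lmul (- 1ℚ) i (Z (suc i)) (L (N ∸ suc i)))
    sum-fromMerge =
      ≋-trans (sum-triangle N (λ a i → lmul (- 1ℚ) i (Z (suc i)) (S (a ∸ i) ⋆ C (N ∸ suc a))))
              (≡⇒≋ (sum-cong-≡ N λ i i<N →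
                 lmul-L (- 1ℚ) i (Z (suc i)) (λ b → N ∸ suc (i + b)) (ℕ.+-∸-assoc 1 i<N)
                        (λ b → sym (ℕ.∸-+-assoc N (suc i) b))))

  serA-· : ∀ m X → serA k (suc (suc m)) · X ≡ lmul 1ℚ (suc m) (Z (suc m)) X ++ lmul (- 1ℚ) m (Z (suc m)) X
  serA-· m X =
    trans (bilin-++ˡ concatW ((1ℚ , suc m , Z (suc m)) ∷ []) ((- 1ℚ , m , Z (suc m)) ∷ []) X)
          (cong₂ _++_ (·-monomial 1ℚ (suc m) (Z (suc m)) X) (·-monomial (- 1ℚ) m (Z (suc m)) X))

  L-zero : L 0 ≋ oneP
  L-zero = ≡⇒≋ (trans (List.++-identityʳ _)
                      (trans (cong (oneP ⋆_) C-zero)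
                             (cong (λ q → (q , 0 , []) ∷ []) (solve 0 ((con 1ℚ :* con 1ℚ) :* con 1ℚ := con 1ℚ) refl))))
    where open +-*-Solver

  L-suc : ∀ N → L (suc N) ≋ ∑[ a < suc (suc N) ] serA k a · L (suc N ∸ a)
  L-suc N = begin
    L (suc N)
      ≈⟨ L-suc-expand ⟩
    (∑[ a < suc N ] fromS a) ++ ((∑[ a < suc N ] fromC a) ++ (∑[ a < N ] fromMerge a))
      ≈⟨ ++-cong sum-fromS (++-cong (≡⇒≋ sum-fromC) sum-fromMerge) ⟩
    (lmul 1ℚ 0 (Z 0) (L N) ++ Up) ++ (lmul (- 1ℚ) 0 z (L N) ++ Down)
      ≡⟨ cong (λ w → (lmul 1ℚ 0 w (L N) ++ Up) ++ (lmul (- 1ℚ) 0 z (L N) ++ Down)) Z-zero ⟩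
    (lmul 1ℚ 0 z (L N) ++ Up) ++ (lmul (- 1ℚ) 0 z (L N) ++ Down)
      ≈⟨ ++-interchange (lmul 1ℚ 0 z (L N)) Up (lmul (- 1ℚ) 0 z (L N)) Down ⟩
    (lmul 1ℚ 0 z (L N) ++ lmul (- 1ℚ) 0 z (L N)) ++ (Up ++ Down)
      ≈⟨ ++-congʳ (Up ++ Down) (lmul-cancel 1ℚ 0 z (L N)) ⟩
    Up ++ Down
      ≈⟨ sum-split N (λ i → lmul 1ℚ (suc i) (Z (suc i)) (L (N ∸ suc i)))
                     (λ i → lmul (- 1ℚ) i (Z (suc i)) (L (N ∸ suc i))) ⟨
    (∑[ i < N ] (lmul 1ℚ (suc i) (Z (suc i)) (L (N ∸ suc i)) ++ lmul (- 1ℚ) i (Z (suc i)) (L (N ∸ suc i))))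
      ≡⟨ sum-cong-≡ N (λ i _ → serA-· i (L (N ∸ suc i))) ⟨
    (∑[ a < suc (suc N) ] serA k a · L (suc N ∸ a)) ∎
    where
    open ≋-Reasoning
    open Expansion N
    Up Down : Poly
    Up   = ∑[ i < N ] lmul 1ℚ (suc i) (Z (suc i)) (L (N ∸ suc i))
    Down = ∑[ i < N ] lmul (- 1ℚ) i (Z (suc i)) (L (N ∸ suc i))

  lhs≋L : ∀ n → lhs k n ≋ L n
  lhs≋L n =
    ≋-trans (≡⇒≋ (concat-map-upTo (λ a → StP (geomPlus k a) ⋆ C (n ∸ a)) (suc n)))
            (sum-cong (suc n) (λ a _ → bilin-congˡ harmW (C (n ∸ a)) (≡⇒≋ (StP-word (zpow k a)))))
    where
    StP-word : ∀ w → StP (word w) ≡ St w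
    StP-word w = trans (List.++-identityʳ _) (lmul-identity (St w))

mainTheorem8 : (k : ℕ) → 1 ≤ k → (n : ℕ) → lhs k n ≈ rhs k n
mainTheorem8 (suc k') (s≤s z≤n) n = coeff-≡ (begin
  lhs (suc k') n    ≈⟨ lhs≋L n ⟩
  L n               ≈⟨ geomPS-unique L L-zero L-suc n ⟩
  rhs (suc k') n    ∎)
  where
  open Coefficients k'
  open GeometricSeries (serA (suc k')) refl
  open ≋-Reasoning
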